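{- Let $\mathcal{M}$ be a partition matroid with unit capacities given by a partition $(P_1,\dots,P_d)$ of its ground set, let $X\subseteq E(\mathcal{M})$, and let $k\ge 0$ and $r\ge 1$ be integers. Then: (i) if there is an integer $s\ge 1$ such that $|X|=s(r-1)+k+1$ and $|X\cap P_i|\le s$ for every $i\in\{1,\dots,d\}$, then $\mathsf{rank}(X\setminus F)\ge r$ for every $F\subseteq X$ with $|F|\le k$; (ii) if $X$ is an inclusion-minimal set such that $\mathsf{rank}(X\setminus F)\ge r$ for every $F\subseteq X$ with $|F|\le k$, then there is an integer $s\ge 1$ such that $|X|=s(r-1)+k+1$ and $|X\cap P_i|\le s$ for every $i\in\{1,\dots,d\}$.
   Context: A partition matroid with unit capacities given by a partition $(P_1,\dots,P_d)$ of a finite ground set $E$ is the matroid on $E$ in which $X\subseteq E$ is independent if and only if $|X\cap P_i|\le 1$ for every $i$. Its rank function is $\mathsf{rank}(X)=|\{i : X\cap P_i\neq\emptyset\}|$. -}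

module Defs where

open import Data.Nat using (ℕ)
open import Data.Bool using (Bool)
open import Data.Fin using (Fin; _≟_)
open import Data.Fin.Subset using (Subset; ∣_∣; _∩_; _─_; _⊆_; _⊂_)
open import Data.Fin.Subset.Properties using (nonempty?)
open import Data.Vec using (tabulate)
open import Relation.Nullary using (does; ¬_)
open import Data.Nat using (_≤_)

-- A partition (P_1,...,P_d) of E into d blocks is
-- encoded by the block-assignment map  blk : Fin n → Fin d  (element e lies
-- in block blk e). Surjectivity (nonempty blocks) is imposed in the statement.

block : ∀ {n d} → (Fin n → Fin d) → Fin d → Subset n
block blk i = tabulate (λ e → does (blk e ≟ i))

rank : ∀ {n d} → (Fin n → Fin d) → Subset n → ℕ
rank {d = d} blk X = ∣ tabulate (λ i → does (nonempty? (X ∩ block blk i))) ∣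

Robust : ∀ {n d} → (Fin n → Fin d) → ℕ → ℕ → Subset n → Set
Robust blk k r X = ∀ (F : Subset _) → F ⊆ X → ∣ F ∣ ≤ k → r ≤ rank blk (X ─ F)

MinimalRobust : ∀ {n d} → (Fin n → Fin d) → ℕ → ℕ → Subset n → Set
MinimalRobust blk k r X = Robust blk k r X × (∀ Y → Y ⊂ X → ¬ Robust blk k r Y)
  where open import Data.Product using (_×_)

-- Robustness only depends on blocks: the cheapest deletion bringing the rank of X down to a
-- set T of blocks removes exactly the elements of X outside T, so X is robust iff every set of
-- fewer than r blocks misses more than k elements of X.  Part (i) is plain counting:
-- s (r - 1) + 1 ≤ ∣ X ─ F ∣ ≤ s · rank (X ─ F).  For (ii), delete from a minimal X an element x₀
-- of a heaviest block i₀, of size s.  A set T of fewer than r blocks missing at most k elements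
-- of X - x₀ must avoid i₀ and miss exactly k + 1 elements of X.  Adding i₀ to T, or swapping i₀
-- for a block j of T, yields block sets that X must still survive; this forces ∣ T ∣ = r - 1 and
-- ∣ X ∩ P_j ∣ = s for all j ∈ T, whence ∣ X ∣ = s (r - 1) + k + 1.

module Submission where

open import Defs
open import Data.Nat using (ℕ; _+_; _*_; _∸_; _≤_; _<_; suc; z≤n; s≤s; _≤?_; _<?_)
open import Data.Nat.Properties hiding (_≟_)
open import Data.Bool using (Bool; true; false; _∧_; if_then_else_)
open import Data.Bool.Properties using (∧-identityʳ; ∧-zeroʳ)
open import Data.Fin as Fin using (Fin; _≟_)
open import Data.Fin.Properties using (punchInᵢ≢i)
open import Data.Fin.Subset
  using (Subset; ∣_∣; _∩_; _─_; _-_; _⊆_; _∈_; _∉_; ⁅_⁆; Nonempty; Empty)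
  renaming (⊥ to ∅)
open import Data.Fin.Subset.Properties
open import Data.Vec using ([]; _∷_; here; there; lookup; tabulate; _[_]≔_)
open import Data.Vec.Properties
  using (lookup∘tabulate; lookup-zipWith; []=⇒lookup; lookup⇒[]=; lookup∘update; lookup∘update′)
open import Data.Vec.Functional using (removeAt)
open import Algebra.Properties.Semiring.Sum +-*-semiring
  using (sum; sum-cong-≗; sum-remove; sum-replicate-zero; ∑-comm; ∑-distrib-+; *-distribˡ-sum)
open import Data.List using (allFin)
open import Data.List.Extrema ≤-totalOrder using (argmax; f[⊥]≤f[argmax]; f[xs]≤f[argmax])
open import Data.List.Relation.Unary.All as All using ()
open import Data.List.Membership.Propositional.Properties using (∈-allFin)
open import Data.Product using (_×_; ∃-syntax; _,_; proj₁; proj₂)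
open import Function using (_∘_)
open import Relation.Nullary using (¬_; yes; no; does; contradiction)
open import Relation.Nullary.Decidable using (dec-true; dec-false; _×-dec_)
open import Relation.Binary.PropositionalEquality
  using (_≡_; _≢_; refl; sym; trans; cong; cong₂; subst; ≢-sym; module ≡-Reasoning)
open import Data.Nat.Solver using (module +-*-Solver)
open +-*-Solver using (solve; _:+_; _:=_; con)

sum-mono-≤ : ∀ {d} {f g : Fin d → ℕ} → (∀ i → f i ≤ g i) → sum f ≤ sum g
sum-mono-≤ {0}     h = z≤n
sum-mono-≤ {suc d} h = +-mono-≤ (h Fin.zero) (sum-mono-≤ (h ∘ Fin.suc))

sum-update : ∀ {d} {f g : Fin d → ℕ} a → (∀ i → i ≢ a → f i ≡ g i) → sum f + g a ≡ sum g + f a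
sum-update {suc d} {f} {g} a f≡g = begin
  sum f + g a                        ≡⟨ cong (_+ g a) (sum-remove {i = a} f) ⟩
  f a + sum (removeAt f a) + g a     ≡⟨ cong (λ x → f a + x + g a) rest ⟩
  f a + sum (removeAt g a) + g a     ≡⟨ swap (f a) _ (g a) ⟩
  g a + sum (removeAt g a) + f a     ≡⟨ cong (_+ f a) (sum-remove {i = a} g) ⟨
  sum g + f a                        ∎
  where
  open ≡-Reasoning
  rest : sum (removeAt f a) ≡ sum (removeAt g a)
  rest = sum-cong-≗ (λ j → f≡g _ (punchInᵢ≢i a j))
  swap : ∀ x y z → x + y + z ≡ z + y + x
  swap = solve 3 (λ x y z → x :+ y :+ z := z :+ y :+ x) refl

sum-δ : ∀ {d} {f : Fin d → ℕ} a → (∀ i → i ≢ a → f i ≡ 0) → sum f ≡ f a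
sum-δ {d} {f} a f≡0 = begin
  sum f                            ≡⟨ +-identityʳ (sum f) ⟨
  sum f + 0                        ≡⟨ sum-update a f≡0 ⟩
  sum {d} (λ _ → 0) + f a          ≡⟨ cong (_+ f a) (sum-replicate-zero d) ⟩
  f a                              ∎
  where open ≡-Reasoning

toℕ : Bool → ℕ
toℕ false = 0
toℕ true  = 1

∣p∣≡sum : ∀ {n} (p : Subset n) → ∣ p ∣ ≡ sum (λ x → toℕ (lookup p x))
∣p∣≡sum []          = refl
∣p∣≡sum (false ∷ p) = ∣p∣≡sum p
∣p∣≡sum (true ∷ p)  = cong suc (∣p∣≡sum p)

∣p∣≤∣p─q∣+∣q∣ : ∀ {n} (p q : Subset n) → ∣ p ∣ ≤ ∣ p ─ q ∣ + ∣ q ∣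
∣p∣≤∣p─q∣+∣q∣ []          []          = z≤n
∣p∣≤∣p─q∣+∣q∣ (false ∷ p) (false ∷ q) = ∣p∣≤∣p─q∣+∣q∣ p q
∣p∣≤∣p─q∣+∣q∣ (true ∷ p)  (false ∷ q) = s≤s (∣p∣≤∣p─q∣+∣q∣ p q)
∣p∣≤∣p─q∣+∣q∣ (false ∷ p) (true ∷ q)  =
  ≤-trans (m≤n⇒m≤1+n (∣p∣≤∣p─q∣+∣q∣ p q)) (≤-reflexive (sym (+-suc _ _)))
∣p∣≤∣p─q∣+∣q∣ (true ∷ p)  (true ∷ q)  =
  ≤-trans (s≤s (∣p∣≤∣p─q∣+∣q∣ p q)) (≤-reflexive (sym (+-suc _ _)))

Empty⇒∣p∣≡0 : ∀ {n} {p : Subset n} → Empty p → ∣ p ∣ ≡ 0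
Empty⇒∣p∣≡0 {n} ¬ne = trans (cong ∣_∣ (Empty-unique ¬ne)) (∣⊥∣≡0 n)

0<∣p∣⇒Nonempty : ∀ {n} (p : Subset n) → 0 < ∣ p ∣ → Nonempty p
0<∣p∣⇒Nonempty p 0<∣p∣ with nonempty? p
... | yes ne  = ne
... | no  ¬ne = contradiction (Empty⇒∣p∣≡0 ¬ne) (>⇒≢ 0<∣p∣)

x∈p⇒0<∣p∣ : ∀ {n} {x : Fin n} {p : Subset n} → x ∈ p → 0 < ∣ p ∣
x∈p⇒0<∣p∣ here                          = s≤s z≤n
x∈p⇒0<∣p∣ (there {y = b} {xs = p} x∈p) = ≤-trans (x∈p⇒0<∣p∣ x∈p) (∣p∣≤∣x∷p∣ b p)

x∈p─q⇒x∉q : ∀ {n} {x : Fin n} {p q : Subset n} → x ∈ p ─ q → x ∉ q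
x∈p─q⇒x∉q {p = _ ∷ _} {false ∷ _} here          ()
x∈p─q⇒x∉q {p = _ ∷ _} {_ ∷ _}     (there x∈p─q) (there x∈q) = x∈p─q⇒x∉q x∈p─q x∈q

∈-tabulate⁺ : ∀ {n} {f : Fin n → Bool} {x} → f x ≡ true → x ∈ tabulate f
∈-tabulate⁺ {f = f} {x} fx = lookup⇒[]= x _ (trans (lookup∘tabulate f x) fx)

∈-tabulate⁻ : ∀ {n} {f : Fin n → Bool} {x} → x ∈ tabulate f → f x ≡ true
∈-tabulate⁻ {f = f} {x} x∈ = trans (sym (lookup∘tabulate f x)) ([]=⇒lookup x∈)

∣p∣≤s*nonempty : ∀ {n} {p : Subset n} {s} → ∣ p ∣ ≤ s → ∣ p ∣ ≤ s * toℕ (does (nonempty? p))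
∣p∣≤s*nonempty {p = p} {s} ∣p∣≤s with nonempty? p
... | yes _   = ≤-trans ∣p∣≤s (≤-reflexive (sym (*-identityʳ s)))
... | no  ¬ne = ≤-reflexive (trans (Empty⇒∣p∣≡0 ¬ne) (sym (*-zeroʳ s)))

p─q⊆r⇒p─r⊆q : ∀ {n} {p q r : Subset n} → p ─ q ⊆ r → p ─ r ⊆ q
p─q⊆r⇒p─r⊆q {q = q} p─q⊆r {x} x∈p─r with x ∈? q
... | yes x∈q = x∈q
... | no  x∉q = contradiction (p─q⊆r (x∈p∧x∉q⇒x∈p─q (p─q⊆p _ _ x∈p─r) x∉q)) (x∈p─q⇒x∉q x∈p─r)

uncovered : ∀ {d} → (Fin d → ℕ) → Subset d → ℕ
uncovered c T = sum (λ i → if lookup T i then 0 else c i)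

sum-[]≔ : ∀ {d} (f : Fin d → Bool → ℕ) (T : Subset d) a {b₀} b → lookup T a ≡ b₀ →
          sum (λ i → f i (lookup (T [ a ]≔ b) i)) + f a b₀ ≡ sum (λ i → f i (lookup T i)) + f a b
sum-[]≔ f T a b refl = trans (sum-update a unchanged) (cong (λ v → _ + f a v) (lookup∘update a T b))
  where
  unchanged : ∀ i → i ≢ a → f i (lookup (T [ a ]≔ b) i) ≡ f i (lookup T i)
  unchanged i i≢a = cong (f i) (lookup∘update′ i≢a T b)

∣T[a]≔b∣ : ∀ {d} (T : Subset d) a {b₀} b → lookup T a ≡ b₀ → ∣ T [ a ]≔ b ∣ + toℕ b₀ ≡ ∣ T ∣ + toℕ b
∣T[a]≔b∣ T a b T[a] = begin
  ∣ T [ a ]≔ b ∣ + _                                 ≡⟨ cong (_+ _) (∣p∣≡sum (T [ a ]≔ b)) ⟩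
  sum (λ i → toℕ (lookup (T [ a ]≔ b) i)) + _        ≡⟨ sum-[]≔ (λ _ → toℕ) T a b T[a] ⟩
  sum (λ i → toℕ (lookup T i)) + toℕ b               ≡⟨ cong (_+ toℕ b) (∣p∣≡sum T) ⟨
  ∣ T ∣ + toℕ b                                      ∎
  where open ≡-Reasoning

uncovered-[]≔ : ∀ {d} (c : Fin d → ℕ) (T : Subset d) a {b₀} b → lookup T a ≡ b₀ →
  uncovered c (T [ a ]≔ b) + (if b₀ then 0 else c a) ≡ uncovered c T + (if b then 0 else c a)
uncovered-[]≔ c = sum-[]≔ (λ i b → if b then 0 else c i)

sum≡s*∣T∣+uncovered : ∀ {d} (c : Fin d → ℕ) (T : Subset d) s → (∀ i → lookup T i ≡ true → c i ≡ s) →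
                      sum c ≡ s * ∣ T ∣ + uncovered c T
sum≡s*∣T∣+uncovered {d} c T s full = begin
  sum c                                                ≡⟨ sum-cong-≗ split ⟩
  sum (λ i → s * toℕ (lookup T i) + (if lookup T i then 0 else c i))
                                                       ≡⟨ ∑-distrib-+ {d} _ _ ⟩
  sum (λ i → s * toℕ (lookup T i)) + uncovered c T     ≡⟨ cong (_+ uncovered c T) (*-distribˡ-sum {d} s _) ⟨
  s * sum (λ i → toℕ (lookup T i)) + uncovered c T     ≡⟨ cong (λ m → s * m + uncovered c T) (∣p∣≡sum T) ⟨
  s * ∣ T ∣ + uncovered c T                            ∎
  where
  open ≡-Reasoning
  split : ∀ i → c i ≡ s * toℕ (lookup T i) + (if lookup T i then 0 else c i)
  split i with lookup T i in T[i]
  ... | true  = trans (full i T[i]) (sym (trans (+-identityʳ _) (*-identityʳ s)))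
  ... | false = cong (_+ c i) (sym (*-zeroʳ s))

module _ {d} (c : Fin d → ℕ) {k r : ℕ} (spread : ∀ T → ∣ T ∣ < r → k < uncovered c T)
         {i₀ : Fin d} (heaviest : ∀ i → c i ≤ c i₀) (0<c[i₀] : 0 < c i₀)
         {T : Subset d} (∣T∣<r : ∣ T ∣ < r) (i₀∉T : lookup T i₀ ≡ false)
         (uncovered≡1+k : uncovered c T ≡ suc k) where

  r≡1+∣T∣ : r ≡ suc ∣ T ∣
  r≡1+∣T∣ = ≤-antisym (≮⇒≥ 1+∣T∣≮r) ∣T∣<r
    where
    T′ : Subset d
    T′ = T [ i₀ ]≔ true
    1+∣T∣≮r : ¬ suc ∣ T ∣ < r
    1+∣T∣≮r 1+∣T∣<r = <⇒≱ (spread T′ ∣T′∣<r) uncovered[T′]≤k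
      where
      ∣T′∣≡1+∣T∣ : ∣ T′ ∣ ≡ suc ∣ T ∣
      ∣T′∣≡1+∣T∣ = trans (sym (+-identityʳ _)) (trans (∣T[a]≔b∣ T i₀ true i₀∉T) (+-comm _ 1))
      ∣T′∣<r : ∣ T′ ∣ < r
      ∣T′∣<r = subst (_< r) (sym ∣T′∣≡1+∣T∣) 1+∣T∣<r
      uncovered[T′]≤k : uncovered c T′ ≤ k
      uncovered[T′]≤k = ≤-pred (<-≤-trans (m<m+n _ 0<c[i₀])
        (≤-reflexive (trans (uncovered-[]≔ c T i₀ true i₀∉T) (trans (+-identityʳ _) uncovered≡1+k))))

  heaviest-on-T : ∀ j → lookup T j ≡ true → c j ≡ c i₀
  heaviest-on-T j T[j] = ≤-antisym (heaviest j) c[i₀]≤c[j]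
    where
    open ≤-Reasoning
    T₁ T₂ : Subset d
    T₁ = T [ j ]≔ false
    T₂ = T₁ [ i₀ ]≔ true
    i₀≢j : i₀ ≢ j
    i₀≢j refl with trans (sym T[j]) i₀∉T
    ... | ()
    T₁[i₀] : lookup T₁ i₀ ≡ false
    T₁[i₀] = trans (lookup∘update′ i₀≢j T false) i₀∉T
    ∣T₂∣≡∣T∣ : ∣ T₂ ∣ ≡ ∣ T ∣
    ∣T₂∣≡∣T∣ = begin-equality
      ∣ T₂ ∣          ≡⟨ +-identityʳ _ ⟨
      ∣ T₂ ∣ + 0      ≡⟨ ∣T[a]≔b∣ T₁ i₀ true T₁[i₀] ⟩
      ∣ T₁ ∣ + 1      ≡⟨ ∣T[a]≔b∣ T j false T[j] ⟩
      ∣ T ∣ + 0       ≡⟨ +-identityʳ _ ⟩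
      ∣ T ∣           ∎
    c[i₀]≤c[j] : c i₀ ≤ c j
    c[i₀]≤c[j] = +-cancelˡ-≤ (suc k) _ _ (begin
      suc k + c i₀              ≤⟨ +-monoˡ-≤ (c i₀) (spread T₂ (subst (_< r) (sym ∣T₂∣≡∣T∣) ∣T∣<r)) ⟩
      uncovered c T₂ + c i₀     ≡⟨ uncovered-[]≔ c T₁ i₀ true T₁[i₀] ⟩
      uncovered c T₁ + 0        ≡⟨ uncovered-[]≔ c T j false T[j] ⟩
      uncovered c T + c j       ≡⟨ cong (_+ c j) uncovered≡1+k ⟩
      suc k + c j               ∎)

  sum≡c[i₀]*[r∸1]+k+1 : sum c ≡ c i₀ * (r ∸ 1) + k + 1
  sum≡c[i₀]*[r∸1]+k+1 = begin
    sum c                            ≡⟨ sum≡s*∣T∣+uncovered c T (c i₀) heaviest-on-T ⟩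
    c i₀ * ∣ T ∣ + uncovered c T     ≡⟨ cong₂ (λ m u → c i₀ * m + u) (cong (_∸ 1) (sym r≡1+∣T∣)) uncovered≡1+k ⟩
    c i₀ * (r ∸ 1) + suc k           ≡⟨ cong (c i₀ * (r ∸ 1) +_) (+-comm 1 k) ⟩
    c i₀ * (r ∸ 1) + (k + 1)         ≡⟨ +-assoc (c i₀ * (r ∸ 1)) k 1 ⟨
    c i₀ * (r ∸ 1) + k + 1           ∎
    where open ≡-Reasoning

module _ {n d : ℕ} (blk : Fin n → Fin d) where

  ∈-block⁺ : ∀ x → x ∈ block blk (blk x)
  ∈-block⁺ x = ∈-tabulate⁺ (dec-true (blk x ≟ blk x) refl)

  ∈-block⁻ : ∀ {i x} → x ∈ block blk i → blk x ≡ i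
  ∈-block⁻ {i} {x} x∈ with blk x ≟ i | ∈-tabulate⁻ {f = λ y → does (blk y ≟ i)} x∈
  ... | yes blkx≡i | _ = blkx≡i

  lookup-∩-block : ∀ (Z : Subset n) i x → lookup (Z ∩ block blk i) x ≡ lookup Z x ∧ does (blk x ≟ i)
  lookup-∩-block Z i x = trans (lookup-zipWith _∧_ x Z _) (cong (lookup Z x ∧_) (lookup∘tabulate _ x))

  ∣Z∣≡∑∣Z∩block∣ : ∀ (Z : Subset n) → ∣ Z ∣ ≡ sum (λ i → ∣ Z ∩ block blk i ∣)
  ∣Z∣≡∑∣Z∩block∣ Z = begin
    ∣ Z ∣                                                      ≡⟨ ∣p∣≡sum Z ⟩
    sum (λ x → toℕ (lookup Z x))                               ≡⟨ sum-cong-≗ (sym ∘ split) ⟩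
    sum (λ x → sum (λ i → toℕ (lookup (Z ∩ block blk i) x)))   ≡⟨ ∑-comm {n} {d} _ ⟩
    sum (λ i → sum (λ x → toℕ (lookup (Z ∩ block blk i) x)))   ≡⟨ sum-cong-≗ (sym ∘ ∣p∣≡sum ∘ (Z ∩_) ∘ block blk) ⟩
    sum (λ i → ∣ Z ∩ block blk i ∣)                            ∎
    where
    open ≡-Reasoning
    split : ∀ x → sum (λ i → toℕ (lookup (Z ∩ block blk i) x)) ≡ toℕ (lookup Z x)
    split x = trans (sum-δ (blk x) other) (cong toℕ own)
      where
      other : ∀ i → i ≢ blk x → toℕ (lookup (Z ∩ block blk i) x) ≡ 0
      other i i≢ = cong toℕ (trans (lookup-∩-block Z i x)
        (trans (cong (lookup Z x ∧_) (dec-false (blk x ≟ i) (≢-sym i≢))) (∧-zeroʳ _)))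
      own : lookup (Z ∩ block blk (blk x)) x ≡ lookup Z x
      own = trans (lookup-∩-block Z (blk x) x)
        (trans (cong (lookup Z x ∧_) (dec-true (blk x ≟ blk x) refl)) (∧-identityʳ _))

  preimage : Subset d → Subset n
  preimage T = tabulate (λ x → lookup T (blk x))

  ∈-preimage⁺ : ∀ T {x} → blk x ∈ T → x ∈ preimage T
  ∈-preimage⁺ T blkx∈T = ∈-tabulate⁺ ([]=⇒lookup blkx∈T)

  ∈-preimage⁻ : ∀ T {x} → x ∈ preimage T → blk x ∈ T
  ∈-preimage⁻ T x∈ = lookup⇒[]= _ _ (∈-tabulate⁻ x∈)

  -- By definition, rank blk Z = ∣ hits Z ∣.
  hits : Subset n → Subset d
  hits Z = tabulate (λ i → does (nonempty? (Z ∩ block blk i)))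

  ∈-hits⁺ : ∀ {Z x} → x ∈ Z → blk x ∈ hits Z
  ∈-hits⁺ {x = x} x∈Z = ∈-tabulate⁺ (dec-true (nonempty? _) (x , x∈p∩q⁺ (x∈Z , ∈-block⁺ x)))

  ∈-hits⁻ : ∀ {Z i} → i ∈ hits Z → Nonempty (Z ∩ block blk i)
  ∈-hits⁻ {Z} {i} i∈
    with nonempty? (Z ∩ block blk i) | ∈-tabulate⁻ {f = λ j → does (nonempty? (Z ∩ block blk j))} i∈
  ... | yes ne | _ = ne

  Z⊆preimage[hits] : ∀ Z → Z ⊆ preimage (hits Z)
  Z⊆preimage[hits] Z = ∈-preimage⁺ (hits Z) ∘ ∈-hits⁺

  rank≤∣T∣ : ∀ {Z T} → Z ⊆ preimage T → rank blk Z ≤ ∣ T ∣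
  rank≤∣T∣ {Z} {T} Z⊆ = p⊆q⇒∣p∣≤∣q∣ hits⊆T
    where
    hits⊆T : hits Z ⊆ T
    hits⊆T i∈ with ∈-hits⁻ i∈
    ... | x , x∈Z∩P with x∈p∩q⁻ Z _ x∈Z∩P
    ... | x∈Z , x∈P = subst (_∈ T) (∈-block⁻ x∈P) (∈-preimage⁻ T (Z⊆ x∈Z))

  ∣Z∣≤s*rank : ∀ Z s → (∀ i → ∣ Z ∩ block blk i ∣ ≤ s) → ∣ Z ∣ ≤ s * rank blk Z
  ∣Z∣≤s*rank Z s bounded = begin
    ∣ Z ∣                                       ≡⟨ ∣Z∣≡∑∣Z∩block∣ Z ⟩
    sum (λ i → ∣ Z ∩ block blk i ∣)             ≤⟨ sum-mono-≤ per-block ⟩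
    sum (λ i → s * toℕ (lookup (hits Z) i))     ≡⟨ *-distribˡ-sum {d} s _ ⟨
    s * sum (λ i → toℕ (lookup (hits Z) i))     ≡⟨ cong (s *_) (∣p∣≡sum (hits Z)) ⟨
    s * rank blk Z                              ∎
    where
    open ≤-Reasoning
    per-block : ∀ i → ∣ Z ∩ block blk i ∣ ≤ s * toℕ (lookup (hits Z) i)
    per-block i = subst (λ b → ∣ Z ∩ block blk i ∣ ≤ s * toℕ b) (sym (lookup∘tabulate _ i))
      (∣p∣≤s*nonempty {p = Z ∩ block blk i} (bounded i))

  Spread : ℕ → ℕ → Subset n → Set
  Spread k r X = ∀ T → ∣ T ∣ < r → k < ∣ X ─ preimage T ∣

  robust⇒spread : ∀ {k r X} → Robust blk k r X → Spread k r X
  robust⇒spread {k} {r} {X} robust T ∣T∣<r with ∣ X ─ preimage T ∣ ≤? k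
  ... | no  ∣F∣≰k = ≰⇒> ∣F∣≰k
  ... | yes ∣F∣≤k = contradiction r≤∣T∣ (<⇒≱ ∣T∣<r)
    where
    r≤∣T∣ : r ≤ ∣ T ∣
    r≤∣T∣ = ≤-trans (robust _ (p─q⊆p X _) ∣F∣≤k) (rank≤∣T∣ {T = T} (p─q⊆r⇒p─r⊆q ⊆-refl))

  spread⇒robust : ∀ {k r X} → Spread k r X → Robust blk k r X
  spread⇒robust {k} {r} {X} spread F _ ∣F∣≤k with r ≤? rank blk (X ─ F)
  ... | yes r≤rank = r≤rank
  ... | no  r≰rank = contradiction k<k (n≮n k)
    where
    k<k : k < k
    k<k = <-≤-trans (spread (hits (X ─ F)) (≰⇒> r≰rank))
            (≤-trans (p⊆q⇒∣p∣≤∣q∣ (p─q⊆r⇒p─r⊆q (Z⊆preimage[hits] (X ─ F)))) ∣F∣≤k)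

  ¬spread⇒cover : ∀ {k r X} → ¬ Spread k r X → ∃[ T ] (∣ T ∣ < r × ∣ X ─ preimage T ∣ ≤ k)
  ¬spread⇒cover {k} {r} {X} ¬spread
    with anySubset? (λ T → (∣ T ∣ <? r) ×-dec (∣ X ─ preimage T ∣ ≤? k))
  ... | yes cover  = cover
  ... | no  ¬cover = contradiction (λ T ∣T∣<r → ≰⇒> (λ ≤k → ¬cover (T , ∣T∣<r , ≤k))) ¬spread

  tight⇒robust : ∀ {k r} X s → 1 ≤ r → ∣ X ∣ ≡ s * (r ∸ 1) + k + 1 →
                 (∀ i → ∣ X ∩ block blk i ∣ ≤ s) → Robust blk k r X
  tight⇒robust {k} {suc r} X s (s≤s z≤n) ∣X∣≡ bounded F _ ∣F∣≤k =
    *-cancelˡ-< s r (rank blk (X ─ F)) (≤-trans s*r<∣X─F∣ (∣Z∣≤s*rank (X ─ F) s bounded─))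
    where
    bounded─ : ∀ i → ∣ (X ─ F) ∩ block blk i ∣ ≤ s
    bounded─ i = ≤-trans (p⊆q⇒∣p∣≤∣q∣ (λ x∈ → let x∈X─F , x∈P = x∈p∩q⁻ _ _ x∈ in
                           x∈p∩q⁺ (p─q⊆p X F x∈X─F , x∈P))) (bounded i)
    s*r<∣X─F∣ : suc (s * r) ≤ ∣ X ─ F ∣
    s*r<∣X─F∣ = +-cancelʳ-≤ k _ _ (begin
      suc (s * r) + k       ≡⟨ shift (s * r) k ⟩
      s * r + k + 1         ≡⟨ ∣X∣≡ ⟨
      ∣ X ∣                 ≤⟨ ∣p∣≤∣p─q∣+∣q∣ X F ⟩
      ∣ X ─ F ∣ + ∣ F ∣     ≤⟨ +-monoʳ-≤ ∣ X ─ F ∣ ∣F∣≤k ⟩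
      ∣ X ─ F ∣ + k         ∎)
      where
      open ≤-Reasoning
      shift : ∀ a b → suc a + b ≡ a + b + 1
      shift = solve 2 (λ a b → con 1 :+ a :+ b := a :+ b :+ con 1) refl

  ∣X─preimage∣≡uncovered : ∀ X T → ∣ X ─ preimage T ∣ ≡ uncovered (λ i → ∣ X ∩ block blk i ∣) T
  ∣X─preimage∣≡uncovered X T = trans (∣Z∣≡∑∣Z∩block∣ (X ─ preimage T)) (sum-cong-≗ per-block)
    where
    per-block : ∀ i → ∣ (X ─ preimage T) ∩ block blk i ∣ ≡ (if lookup T i then 0 else ∣ X ∩ block blk i ∣)
    per-block i with lookup T i in T[i]
    ... | true  = Empty⇒∣p∣≡0 {p = (X ─ preimage T) ∩ block blk i} empty
      where
      empty : Empty ((X ─ preimage T) ∩ block blk i)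
      empty (x , x∈) with x∈p∩q⁻ _ _ x∈
      ... | x∈X─T , x∈P =
        x∈p─q⇒x∉q x∈X─T (∈-preimage⁺ T (subst (_∈ T) (sym (∈-block⁻ x∈P)) (lookup⇒[]= i T T[i])))
    ... | false = ≤-antisym (p⊆q⇒∣p∣≤∣q∣ {p = (X ─ preimage T) ∩ block blk i} narrow)
                            (p⊆q⇒∣p∣≤∣q∣ {p = X ∩ block blk i} widen)
      where
      narrow : (X ─ preimage T) ∩ block blk i ⊆ X ∩ block blk i
      narrow x∈ = let x∈X─T , x∈P = x∈p∩q⁻ _ _ x∈ in x∈p∩q⁺ (p─q⊆p X _ x∈X─T , x∈P)
      widen : X ∩ block blk i ⊆ (X ─ preimage T) ∩ block blk i
      widen x∈ with x∈p∩q⁻ _ _ x∈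
      ... | x∈X , x∈P = x∈p∩q⁺ (x∈p∧x∉q⇒x∈p─q x∈X x∉T , x∈P)
        where
        x∉T : _ ∉ preimage T
        x∉T x∈T with trans (sym T[i]) (subst (λ j → lookup T j ≡ true) (∈-block⁻ x∈P)
                                              ([]=⇒lookup (∈-preimage⁻ T x∈T)))
        ... | ()

  module _ {k r} (X : Subset n) (spread : Spread k r X) (x₀ : Fin n) (T : Subset d) (∣T∣<r : ∣ T ∣ < r)
           (∣X-x₀─T∣≤k : ∣ X - x₀ ─ preimage T ∣ ≤ k) where

    X─T-x₀≡X-x₀─T : X ─ preimage T - x₀ ≡ X - x₀ ─ preimage T
    X─T-x₀≡X-x₀─T = p─q─r≡p─r─q X (preimage T) ⁅ x₀ ⁆

    blk[x₀]∉T : lookup T (blk x₀) ≡ false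
    blk[x₀]∉T with lookup T (blk x₀) in T[blk[x₀]]
    ... | false = refl
    ... | true  = contradiction
      (<-≤-trans (spread T ∣T∣<r) (≤-trans (p⊆q⇒∣p∣≤∣q∣ X─T⊆X-x₀─T) ∣X-x₀─T∣≤k)) (n≮n k)
      where
      x₀∈T : x₀ ∈ preimage T
      x₀∈T = ∈-preimage⁺ T (lookup⇒[]= _ T T[blk[x₀]])
      X─T⊆X-x₀─T : X ─ preimage T ⊆ X - x₀ ─ preimage T
      X─T⊆X-x₀─T x∈ = subst (_ ∈_) X─T-x₀≡X-x₀─T (x∈p∧x≢y⇒x∈p-y x∈ (λ { refl → x∈p─q⇒x∉q x∈ x₀∈T }))

    ∣X─T∣≡1+k : ∣ X ─ preimage T ∣ ≡ suc k
    ∣X─T∣≡1+k = ≤-antisym (begin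
      ∣ X ─ preimage T ∣                           ≤⟨ ∣p∣≤∣p─q∣+∣q∣ (X ─ preimage T) ⁅ x₀ ⁆ ⟩
      ∣ X ─ preimage T - x₀ ∣ + ∣ ⁅ x₀ ⁆ ∣         ≡⟨ cong₂ _+_ (cong ∣_∣ X─T-x₀≡X-x₀─T) (∣⁅x⁆∣≡1 x₀) ⟩
      ∣ X - x₀ ─ preimage T ∣ + 1                  ≤⟨ +-monoˡ-≤ 1 ∣X-x₀─T∣≤k ⟩
      k + 1                                        ≡⟨ +-comm k 1 ⟩
      suc k                                        ∎) (spread T ∣T∣<r)
      where open ≤-Reasoning

  spread⇒Nonempty : ∀ {k r X} → 0 < r → Spread k r X → Nonempty X
  spread⇒Nonempty {k} {r} {X} 0<r spread =
    0<∣p∣⇒Nonempty X (<-≤-trans (≤-<-trans z≤n (spread ∅ ∣∅∣<r)) (∣p─q∣≤∣p∣ X (preimage ∅)))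
    where
    ∣∅∣<r : ∣ ∅ {d} ∣ < r
    ∣∅∣<r = subst (_< r) (sym (∣⊥∣≡0 d)) 0<r

  ∈-heaviest-block : ∀ {X} → Nonempty X →
    ∃[ x₀ ] (x₀ ∈ X × ∀ i → ∣ X ∩ block blk i ∣ ≤ ∣ X ∩ block blk (blk x₀) ∣)
  ∈-heaviest-block {X} (x₁ , x₁∈X) = x₀ , x₀∈X , λ i → subst (λ j → c i ≤ c j) (sym blk[x₀]≡i₀) (heaviest i)
    where
    c : Fin d → ℕ
    c i = ∣ X ∩ block blk i ∣
    i₀ : Fin d
    i₀ = argmax c (blk x₁) (allFin d)
    heaviest : ∀ i → c i ≤ c i₀
    heaviest i = All.lookup (f[xs]≤f[argmax] (blk x₁) (allFin d)) (∈-allFin i)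
    0<c[i₀] : 0 < c i₀
    0<c[i₀] = <-≤-trans (x∈p⇒0<∣p∣ {p = X ∩ block blk (blk x₁)} (x∈p∩q⁺ (x₁∈X , ∈-block⁺ x₁)))
                        (f[⊥]≤f[argmax] {f = c} (blk x₁) (allFin d))
    x₀-in-block : Nonempty (X ∩ block blk i₀)
    x₀-in-block = 0<∣p∣⇒Nonempty _ 0<c[i₀]
    x₀ : Fin n
    x₀ = proj₁ x₀-in-block
    x₀∈X : x₀ ∈ X
    x₀∈X = proj₁ (x∈p∩q⁻ X _ (proj₂ x₀-in-block))
    blk[x₀]≡i₀ : blk x₀ ≡ i₀
    blk[x₀]≡i₀ = ∈-block⁻ (proj₂ (x∈p∩q⁻ X _ (proj₂ x₀-in-block)))

  minimalRobust⇒tight : ∀ {k r X} → 1 ≤ r → MinimalRobust blk k r X →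
    ∃[ s ] (1 ≤ s × ∣ X ∣ ≡ s * (r ∸ 1) + k + 1 × (∀ i → ∣ X ∩ block blk i ∣ ≤ s))
  minimalRobust⇒tight {k} {r} {X} 1≤r (robust , minimal)
    with ∈-heaviest-block (spread⇒Nonempty 1≤r (robust⇒spread robust))
  ... | x₀ , x₀∈X , heaviest
    with ¬spread⇒cover {k} {r} {X - x₀} (minimal (X - x₀) (x∈p⇒p-x⊂p x₀∈X) ∘ spread⇒robust)
  ... | T , ∣T∣<r , ∣X-x₀─T∣≤k = c i₀ , 0<c[i₀] , ∣X∣≡ , heaviest
    where
    c : Fin d → ℕ
    c i = ∣ X ∩ block blk i ∣
    i₀ : Fin d
    i₀ = blk x₀
    0<c[i₀] : 0 < c i₀
    0<c[i₀] = x∈p⇒0<∣p∣ {p = X ∩ block blk i₀} (x∈p∩q⁺ (x₀∈X , ∈-block⁺ x₀))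
    spreadX : Spread k r X
    spreadX = robust⇒spread robust
    spread : ∀ T → ∣ T ∣ < r → k < uncovered c T
    spread T ∣T∣<r = subst (k <_) (∣X─preimage∣≡uncovered X T) (spreadX T ∣T∣<r)
    ∣X∣≡ : ∣ X ∣ ≡ c i₀ * (r ∸ 1) + k + 1
    ∣X∣≡ = trans (∣Z∣≡∑∣Z∩block∣ X)
      (sum≡c[i₀]*[r∸1]+k+1 c spread heaviest 0<c[i₀] {T} ∣T∣<r
        (blk[x₀]∉T X spreadX x₀ T ∣T∣<r ∣X-x₀─T∣≤k)
        (trans (sym (∣X─preimage∣≡uncovered X T)) (∣X─T∣≡1+k X spreadX x₀ T ∣T∣<r ∣X-x₀─T∣≤k)))

lemma11 : ∀ {n d : ℕ} (blk : Fin n → Fin d) → (∀ i → ∃[ e ] blk e ≡ i) →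
          (X : Subset n) (k r : ℕ) → 1 ≤ r →
          ((∃[ s ] (1 ≤ s × ∣ X ∣ ≡ s * (r ∸ 1) + k + 1 × (∀ i → ∣ X ∩ block blk i ∣ ≤ s)))
            → Robust blk k r X)
          ×
          (MinimalRobust blk k r X →
            ∃[ s ] (1 ≤ s × ∣ X ∣ ≡ s * (r ∸ 1) + k + 1 × (∀ i → ∣ X ∩ block blk i ∣ ≤ s)))
lemma11 blk _ X k r 1≤r =
  (λ (s , _ , ∣X∣≡ , bounded) → tight⇒robust blk {k} X s 1≤r ∣X∣≡ bounded) ,
  minimalRobust⇒tight blk {k} {r} {X} 1≤r
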